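{- Let $c\ge 3$ be an integer and let $F_c$ be the $c$-forced gadget. Then $F_c$ admits a good $c$-edge-labeling, and for every good edge-labeling $\lambda: E(F_c)\to\{1,\dots,c\}$ of $F_c$, the bone $vv_1$ of $F_c$ satisfies $\lambda(vv_1)\in\{1,c\}$.
   Context: An edge-labeling of a graph $G$ is a function $\lambda:E(G)\to\mathbb{R}$; it is a $c$-edge-labeling if it takes at most $c$ distinct values. A path is increasing if the sequence of labels of its edges, read along the path, is non-decreasing. An edge-labeling is good if for every ordered pair of vertices $(x,y)$ there are no two distinct increasing paths from $x$ to $y$. For $d\ge1$, $D_d$ is the graph with vertex set $\{v,v_1,\dots,v_d\}\cup\{v_{i,j}:1\le i<j\le d\}$ and edges $vv_i$ ($i\in[d]$) and $v_iv_{i,j}, v_jv_{i,j}$ ($1\le i<j\le d$). The extremal gadget is the graph with vertex set $\{a,p_1,p_2,q_1,q_2,u_1,u_2\}$ and edges $ap_1,ap_2,p_1u_1,p_2u_1,aq_1,aq_2,q_1u_2,q_2u_2,u_1u_2$; its bone is $u_1u_2$. The $c$-forced gadget $F_c$ is obtained from $D_{c-1}$ by taking, for each $i\in\{2,\dots,c-1\}$, a new copy $X_i$ of the extremal gadget and identifying the edge $vv_i$ with the bone of $X_i$ (identifying the endpoints pairwise); the bone of $F_c$ is the edge $vv_1$. -}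

module Defs where

open import Data.Nat using (ℕ; zero; suc; _≤_; _∸_; z≤n; s≤s)
open import Data.Fin as Fin using (Fin; toℕ)
open import Data.Product using (_×_; _,_; Σ; proj₁)
open import Data.Sum using (_⊎_)
open import Data.List using (List; []; _∷_; map)
open import Data.List.Relation.Unary.Unique.Propositional using (Unique)
open import Data.List.Relation.Unary.Linked using (Linked)
open import Relation.Binary.PropositionalEquality using (_≡_)

record Graph : Set₁ where
  field
    V    : Set
    E    : Set
    ends : E → V × V

module _ (G : Graph) where
  open Graph G

  Joins : E → V → V → Set
  Joins e x z = (ends e ≡ (x , z)) ⊎ (ends e ≡ (z , x))

  data Walk : V → V → Set where
    [] : (x : V) → Walk x x
    step : {y : V} (x : V) (e : E) (z : V) → Joins e x z → Walk z y → Walk x y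

  walkVertices : {x y : V} → Walk x y → List V
  walkVertices ([] x) = x ∷ []
  walkVertices (step x e z _ w) = x ∷ walkVertices w

  walkEdges : {x y : V} → Walk x y → List E
  walkEdges ([] x) = []
  walkEdges (step x e z _ w) = e ∷ walkEdges w

  IsPath : {x y : V} → Walk x y → Set
  IsPath w = Unique (walkVertices w)

  -- an edge-labeling (real labels replaced by ℕ)
  Labeling : Set
  Labeling = E → ℕ

  Increasing : Labeling → {x y : V} → Walk x y → Set
  Increasing λ′ w = Linked _≤_ (map λ′ (walkEdges w))

  -- good: for every ordered pair (x,y) no two distinct increasing paths
  -- from x to y (paths from x are identified by their edge sequences)
  Good : Labeling → Set
  Good λ′ = (x y : V) (p q : Walk x y) → IsPath p → IsPath q →
            Increasing λ′ p → Increasing λ′ q → walkEdges p ≡ walkEdges q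

  ValuesIn1to : ℕ → Labeling → Set
  ValuesIn1to c λ′ = (e : E) → (1 ≤ λ′ e) × (λ′ e ≤ c)

-- The c-forced gadget F_c, built on D_d with d = c - 1.
-- Index i : Fin d stands for the 1-based index (toℕ i + 1), so v_1 is
-- arm Fin.zero, and the indices i ∈ {2,…,c-1} are those with 1 ≤ toℕ i.

-- the new vertices of a copy of the extremal gadget (u₁,u₂ are identified)
data GadgetV : Set where
  ga gp₁ gp₂ gq₁ gq₂ : GadgetV

-- the edges of the extremal gadget other than the bone u₁u₂
data GadgetE : Set where
  ap₁ ap₂ p₁u₁ p₂u₁ aq₁ aq₂ q₁u₂ q₂u₂ : GadgetE

data FV (d : ℕ) : Set where
  hub  : FV d
  arm  : Fin d → FV d
  mid  : (i j : Fin d) → i Fin.< j → FV d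
  gad  : (i : Fin d) → 1 ≤ toℕ i → GadgetV → FV d

data FE (d : ℕ) : Set where
  spoke : Fin d → FE d
  legˡ  : (i j : Fin d) → i Fin.< j → FE d
  legʳ  : (i j : Fin d) → i Fin.< j → FE d
  gadE  : (i : Fin d) → 1 ≤ toℕ i → GadgetE → FE d

-- in X_i, u₁ is identified with v and u₂ with v_i
FEnds : (d : ℕ) → FE d → FV d × FV d
FEnds d (spoke i) = hub , arm i
FEnds d (legˡ i j p) = arm i , mid i j p
FEnds d (legʳ i j p) = arm j , mid i j p
FEnds d (gadE i h ap₁)  = gad i h ga , gad i h gp₁
FEnds d (gadE i h ap₂)  = gad i h ga , gad i h gp₂
FEnds d (gadE i h p₁u₁) = gad i h gp₁ , hub
FEnds d (gadE i h p₂u₁) = gad i h gp₂ , hub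
FEnds d (gadE i h aq₁)  = gad i h ga , gad i h gq₁
FEnds d (gadE i h aq₂)  = gad i h ga , gad i h gq₂
FEnds d (gadE i h q₁u₂) = gad i h gq₁ , arm i
FEnds d (gadE i h q₂u₂) = gad i h gq₂ , arm i

ForcedGadget : ℕ → Graph
ForcedGadget c = record { V = FV (c ∸ 1) ; E = FE (c ∸ 1) ; ends = FEnds (c ∸ 1) }

-- the bone v v_1 of F_c (needs c ≥ 2 so that v_1 exists)
bone : (c : ℕ) → 3 ≤ c → FE (c ∸ 1)
bone (suc (suc c)) _ = spoke Fin.zero
bone (suc zero) (s≤s ())

{-# OPTIONS --safe #-}
module Submission where

-- In a good labeling two increasing paths with the same ends leave through the same
-- vertex. In a copy of the extremal gadget, for each of the pairs a–p₁–v, a–p₂–v and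
-- a–q₁–vᵢ, a–q₂–vᵢ one path is increasing towards a; so if the bone v vᵢ had a label
-- no larger than both qvᵢ edges, v–vᵢ–q–a and v–p–a would be two increasing paths (and
-- dually for the largest label). Hence the spokes v vᵢ with i ≥ 2 avoid the labels 1 and c,
-- and the 4-cycles v vᵢ vᵢⱼ vⱼ force distinct spokes to have distinct labels: c - 1 spokes
-- cannot share the c - 2 labels strictly between 1 and c, so v v₁ gets 1 or c.
--
-- Conversely, label v vᵢ by i and every other edge by 1 or c so that the edges of each of
-- these two labels form vertex-disjoint stars. An increasing path then uses label-1 edges,
-- then spokes, then label-c edges, and following these phases shows that its first hop
-- is determined by its two ends.

open import Defs
open import Data.Nat using (ℕ; suc; _+_; _≤_; _<_; _∸_; z≤n; s≤s; _≤?_; _≟_)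
import Data.Nat.Properties as ℕₚ
open ℕₚ using (≤-refl; ≤-trans)
open import Data.Fin as Fin using (Fin; toℕ)
import Data.Fin.Properties as Finₚ
open import Data.Product using (Σ; _×_; _,_; ∃; ∃₂; proj₁; proj₂)
open import Data.Product.Properties using (,-injective)
open import Data.Sum using (_⊎_; inj₁; inj₂)
open import Data.Empty using (⊥; ⊥-elim)
open import Data.List using ([]; _∷_; map)
import Data.List.Properties as Listₚ
open import Data.List.Relation.Unary.All using (All; []; _∷_)
open import Data.List.Relation.Unary.AllPairs using ([]; _∷_)
open import Data.List.Relation.Unary.Linked as Linked using (Linked; []; [-]; _∷_)
open import Function using (_∘_)
open import Relation.Nullary using (yes; no; ¬_)
open import Relation.Binary.PropositionalEquality
  using (_≡_; _≢_; refl; sym; trans; cong; subst; module ≡-Reasoning)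

module _ {G : Graph} where
  open Graph G

  firstHop : ∀ {x y} → Walk G x y → V
  firstHop ([] x) = x
  firstHop (step _ _ z _ _) = z

  All-walkVertices-start : ∀ {P : V → Set} {x y} (p : Walk G x y) → All P (walkVertices G p) → P x
  All-walkVertices-start ([] _) (px ∷ _) = px
  All-walkVertices-start (step _ _ _ _ _) (px ∷ _) = px

  All-walkVertices-end : ∀ {P : V → Set} {x y} (p : Walk G x y) → All P (walkVertices G p) → P y
  All-walkVertices-end ([] _) (py ∷ _) = py
  All-walkVertices-end (step _ _ _ _ p) (_ ∷ ps) = All-walkVertices-end p ps

  joins-sym : ∀ {e x z} → Joins G e x z → Joins G e z x
  joins-sym (inj₁ eq) = inj₂ eq
  joins-sym (inj₂ eq) = inj₁ eq

  joins-far-end : ∀ {e x z z′} → Joins G e x z → Joins G e x z′ → z ≡ z′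
  joins-far-end (inj₁ p) (inj₁ q) with refl , refl ← ,-injective (trans (sym p) q) = refl
  joins-far-end (inj₁ p) (inj₂ q) with refl , refl ← ,-injective (trans (sym p) q) = refl
  joins-far-end (inj₂ p) (inj₁ q) with refl , refl ← ,-injective (trans (sym p) q) = refl
  joins-far-end (inj₂ p) (inj₂ q) with refl , refl ← ,-injective (trans (sym p) q) = refl

  firstHop-determined-by-edges : ∀ {x y} (p q : Walk G x y) →
                                 walkEdges G p ≡ walkEdges G q → firstHop p ≡ firstHop q
  firstHop-determined-by-edges ([] _) ([] _) _ = refl
  firstHop-determined-by-edges ([] _) (step _ _ _ _ _) ()
  firstHop-determined-by-edges (step _ _ _ _ _) ([] _) ()
  firstHop-determined-by-edges (step _ _ _ j _) (step _ _ _ j′ _) eq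
    with refl ← Listₚ.∷-injectiveˡ eq = joins-far-end j j′

  NoParallelEdges : Set
  NoParallelEdges = ∀ {x z e e′} → Joins G e x z → Joins G e′ x z → e ≡ e′

  record Cherry (x m y : V) (e f : E) : Set where
    constructor cherry
    field
      x─m : Joins G e x m
      m─y : Joins G f m y
      x≢m : x ≢ m
      x≢y : x ≢ y
      m≢y : m ≢ y

  module _ {x m y e f} (c : Cherry x m y e f) where
    open Cherry c

    cherry-walk : Walk G x y
    cherry-walk = step x e m x─m (step m f y m─y ([] y))

    cherry-isPath : IsPath G cherry-walk
    cherry-isPath = (x≢m ∷ x≢y ∷ []) ∷ (m≢y ∷ []) ∷ [] ∷ []

    cherry-reverse : Cherry y m x f e
    cherry-reverse = cherry (joins-sym m─y) (joins-sym x─m) (m≢y ∘ sym) (x≢y ∘ sym) (x≢m ∘ sym)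

  module _ {lab : Labeling G} (good : Good G lab) where

    good⇒firstHop-unique : ∀ {x y} (p q : Walk G x y) → IsPath G p → IsPath G q →
                           Increasing G lab p → Increasing G lab q → firstHop p ≡ firstHop q
    good⇒firstHop-unique p q p-path q-path p-inc q-inc =
      firstHop-determined-by-edges p q (good _ _ p q p-path q-path p-inc q-inc)

    good⇒rising-cherries-meet : ∀ {x m m′ y e f e′ f′} →
                                Cherry x m y e f → Cherry x m′ y e′ f′ →
                                lab e ≤ lab f → lab e′ ≤ lab f′ → m ≡ m′
    good⇒rising-cherries-meet c c′ rise rise′ =
      good⇒firstHop-unique (cherry-walk c) (cherry-walk c′) (cherry-isPath c) (cherry-isPath c′)
                           (rise ∷ [-]) (rise′ ∷ [-])

    good⇒falling-cherry : ∀ {x m m′ y e f e′ f′} →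
                          Cherry x m y e f → Cherry x m′ y e′ f′ → m ≢ m′ →
                          lab f ≤ lab e ⊎ lab f′ ≤ lab e′
    good⇒falling-cherry {e = e} {f} {e′} {f′} c c′ m≢m′ with lab e ≤? lab f | lab e′ ≤? lab f′
    ... | no e≰f | _        = inj₁ (ℕₚ.≰⇒≥ e≰f)
    ... | yes _  | no e′≰f′ = inj₂ (ℕₚ.≰⇒≥ e′≰f′)
    ... | yes e≤f | yes e′≤f′ = ⊥-elim (m≢m′ (good⇒rising-cherries-meet c c′ e≤f e′≤f′))

    -- The 4-cycle x–m–y–m′–x: a level side would be increasing in both directions,
    -- while the other side is increasing in at least one.
    good⇒no-level-cherry : ∀ {x m m′ y e f e′ f′} →
                           Cherry x m y e f → Cherry x m′ y e′ f′ → m ≢ m′ → lab e ≢ lab f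
    good⇒no-level-cherry {e = e} {f} {e′} {f′} c c′ m≢m′ level with ℕₚ.≤-total (lab e′) (lab f′)
    ... | inj₁ e′≤f′ = m≢m′ (good⇒rising-cherries-meet c c′ (ℕₚ.≤-reflexive level) e′≤f′)
    ... | inj₂ f′≤e′ = m≢m′ (good⇒rising-cherries-meet (cherry-reverse c) (cherry-reverse c′)
                                                        (ℕₚ.≤-reflexive (sym level)) f′≤e′)

  -- Reach x z w ℓ should contain every state (w , ℓ) at the end of an increasing path
  -- that starts with the edge x z, ends with label ℓ and does not return to x.
  record FirstHopInvariant (lab : Labeling G) : Set₁ where
    field
      Reach            : V → V → V → ℕ → Set
      reach-start      : ∀ {x z e} → Joins G e x z → Reach x z z (lab e)
      reach-step       : ∀ {x z w w′ ℓ f} → Reach x z w ℓ → Joins G f w w′ → ℓ ≤ lab f → x ≢ w′ →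
                         Reach x z w′ (lab f)
      reach-hop-unique : ∀ {x z z′ y ℓ ℓ′} → Reach x z y ℓ → Reach x z′ y ℓ′ → z ≡ z′

  good-from-invariant : ∀ {lab} → NoParallelEdges → FirstHopInvariant lab → Good G lab
  good-from-invariant {lab} edge-unique inv = good
    where
      open FirstHopInvariant inv

      reach-end : ∀ {x z w y ℓ} → Reach x z w ℓ → (p : Walk G w y) →
                  Linked _≤_ (ℓ ∷ map lab (walkEdges G p)) → All (x ≢_) (walkVertices G p) →
                  ∃ (Reach x z y)
      reach-end r ([] _) _ _ = _ , r
      reach-end r (step _ _ _ j p) (ℓ≤ ∷ inc) (_ ∷ avoid) =
        reach-end (reach-step r j ℓ≤ (All-walkVertices-start p avoid)) p inc avoid

      good : Good G lab
      good _ _ ([] _) ([] _) _ _ _ _ = refl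
      good _ _ ([] _) (step _ _ _ _ q) _ (avoid ∷ _) _ _ = ⊥-elim (All-walkVertices-end q avoid refl)
      good _ _ (step _ _ _ _ p) ([] _) (avoid ∷ _) _ _ _ = ⊥-elim (All-walkVertices-end p avoid refl)
      good _ y (step _ e z j p) (step _ e′ z′ j′ q) (avoid ∷ p-path) (avoid′ ∷ q-path) p-inc q-inc
        with _ , r ← reach-end (reach-start j) p p-inc avoid
           | _ , r′ ← reach-end (reach-start j′) q q-inc avoid′
        with refl ← reach-hop-unique r r′
        with refl ← edge-unique j j′
        = cong (e ∷_) (good z y p q p-path q-path (Linked.tail p-inc) (Linked.tail q-inc))

pigeonhole-interval : ∀ {n lo} (f : Fin (suc n) → ℕ) → (∀ i → lo ≤ f i × f i < lo + n) →
                      ∃₂ λ i j → i Fin.< j × f i ≡ f j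
pigeonhole-interval {n} {lo} f inside = collide (Finₚ.pigeonhole (ℕₚ.n<1+n n) shifted)
  where
    offset< : ∀ i → f i ∸ lo < n
    offset< i = subst (f i ∸ lo <_) (ℕₚ.m+n∸m≡n lo n)
                      (ℕₚ.∸-monoˡ-< (proj₂ (inside i)) (proj₁ (inside i)))

    shifted : Fin (suc n) → Fin n
    shifted i = Fin.fromℕ< (offset< i)

    collide : (∃₂ λ i j → i Fin.< j × shifted i ≡ shifted j) → ∃₂ λ i j → i Fin.< j × f i ≡ f j
    collide (i , j , i<j , same) =
      i , j , i<j , ℕₚ.∸-cancelʳ-≡ (proj₁ (inside i)) (proj₁ (inside j)) (begin
        f i ∸ lo          ≡⟨ Finₚ.toℕ-fromℕ< (offset< i) ⟨
        toℕ (shifted i)   ≡⟨ cong toℕ same ⟩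
        toℕ (shifted j)   ≡⟨ Finₚ.toℕ-fromℕ< (offset< j) ⟩
        f j ∸ lo          ∎)
      where open ≡-Reasoning

-- ⁺ traverses an edge from the first to the second component of FEnds, ⁻ backwards.
data Arc {d : ℕ} : FV d → FV d → FE d → Set where
  spoke⁺ : ∀ {i} → Arc hub (arm i) (spoke i)
  spoke⁻ : ∀ {i} → Arc (arm i) hub (spoke i)
  legˡ⁺  : ∀ {i j p} → Arc (arm i) (mid i j p) (legˡ i j p)
  legˡ⁻  : ∀ {i j p} → Arc (mid i j p) (arm i) (legˡ i j p)
  legʳ⁺  : ∀ {i j p} → Arc (arm j) (mid i j p) (legʳ i j p)
  legʳ⁻  : ∀ {i j p} → Arc (mid i j p) (arm j) (legʳ i j p)
  ap₁⁺   : ∀ {k h} → Arc (gad k h ga) (gad k h gp₁) (gadE k h ap₁)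
  ap₁⁻   : ∀ {k h} → Arc (gad k h gp₁) (gad k h ga) (gadE k h ap₁)
  ap₂⁺   : ∀ {k h} → Arc (gad k h ga) (gad k h gp₂) (gadE k h ap₂)
  ap₂⁻   : ∀ {k h} → Arc (gad k h gp₂) (gad k h ga) (gadE k h ap₂)
  p₁u₁⁺  : ∀ {k h} → Arc (gad k h gp₁) hub (gadE k h p₁u₁)
  p₁u₁⁻  : ∀ {k h} → Arc hub (gad k h gp₁) (gadE k h p₁u₁)
  p₂u₁⁺  : ∀ {k h} → Arc (gad k h gp₂) hub (gadE k h p₂u₁)
  p₂u₁⁻  : ∀ {k h} → Arc hub (gad k h gp₂) (gadE k h p₂u₁)
  aq₁⁺   : ∀ {k h} → Arc (gad k h ga) (gad k h gq₁) (gadE k h aq₁)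
  aq₁⁻   : ∀ {k h} → Arc (gad k h gq₁) (gad k h ga) (gadE k h aq₁)
  aq₂⁺   : ∀ {k h} → Arc (gad k h ga) (gad k h gq₂) (gadE k h aq₂)
  aq₂⁻   : ∀ {k h} → Arc (gad k h gq₂) (gad k h ga) (gadE k h aq₂)
  q₁u₂⁺  : ∀ {k h} → Arc (gad k h gq₁) (arm k) (gadE k h q₁u₂)
  q₁u₂⁻  : ∀ {k h} → Arc (arm k) (gad k h gq₁) (gadE k h q₁u₂)
  q₂u₂⁺  : ∀ {k h} → Arc (gad k h gq₂) (arm k) (gadE k h q₂u₂)
  q₂u₂⁻  : ∀ {k h} → Arc (arm k) (gad k h gq₂) (gadE k h q₂u₂)

arc : ∀ {c} {e : FE (c ∸ 1)} {x y} → Joins (ForcedGadget c) e x y → Arc x y e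
arc {e = spoke _}          (inj₁ refl) = spoke⁺
arc {e = spoke _}          (inj₂ refl) = spoke⁻
arc {e = legˡ _ _ _}       (inj₁ refl) = legˡ⁺
arc {e = legˡ _ _ _}       (inj₂ refl) = legˡ⁻
arc {e = legʳ _ _ _}       (inj₁ refl) = legʳ⁺
arc {e = legʳ _ _ _}       (inj₂ refl) = legʳ⁻
arc {e = gadE _ _ ap₁}     (inj₁ refl) = ap₁⁺
arc {e = gadE _ _ ap₁}     (inj₂ refl) = ap₁⁻
arc {e = gadE _ _ ap₂}     (inj₁ refl) = ap₂⁺
arc {e = gadE _ _ ap₂}     (inj₂ refl) = ap₂⁻
arc {e = gadE _ _ p₁u₁}    (inj₁ refl) = p₁u₁⁺
arc {e = gadE _ _ p₁u₁}    (inj₂ refl) = p₁u₁⁻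
arc {e = gadE _ _ p₂u₁}    (inj₁ refl) = p₂u₁⁺
arc {e = gadE _ _ p₂u₁}    (inj₂ refl) = p₂u₁⁻
arc {e = gadE _ _ aq₁}     (inj₁ refl) = aq₁⁺
arc {e = gadE _ _ aq₁}     (inj₂ refl) = aq₁⁻
arc {e = gadE _ _ aq₂}     (inj₁ refl) = aq₂⁺
arc {e = gadE _ _ aq₂}     (inj₂ refl) = aq₂⁻
arc {e = gadE _ _ q₁u₂}    (inj₁ refl) = q₁u₂⁺
arc {e = gadE _ _ q₁u₂}    (inj₂ refl) = q₁u₂⁻
arc {e = gadE _ _ q₂u₂}    (inj₁ refl) = q₂u₂⁺
arc {e = gadE _ _ q₂u₂}    (inj₂ refl) = q₂u₂⁻

arc-unique : ∀ {d} {x y : FV d} {e e′} → Arc x y e → Arc x y e′ → e ≡ e′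
arc-unique spoke⁺ spoke⁺ = refl
arc-unique spoke⁻ spoke⁻ = refl
arc-unique legˡ⁺ legˡ⁺ = refl
arc-unique legˡ⁻ legˡ⁻ = refl
arc-unique legʳ⁺ legʳ⁺ = refl
arc-unique legʳ⁻ legʳ⁻ = refl
arc-unique ap₁⁺ ap₁⁺ = refl
arc-unique ap₁⁻ ap₁⁻ = refl
arc-unique ap₂⁺ ap₂⁺ = refl
arc-unique ap₂⁻ ap₂⁻ = refl
arc-unique p₁u₁⁺ p₁u₁⁺ = refl
arc-unique p₁u₁⁻ p₁u₁⁻ = refl
arc-unique p₂u₁⁺ p₂u₁⁺ = refl
arc-unique p₂u₁⁻ p₂u₁⁻ = refl
arc-unique aq₁⁺ aq₁⁺ = refl
arc-unique aq₁⁻ aq₁⁻ = refl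
arc-unique aq₂⁺ aq₂⁺ = refl
arc-unique aq₂⁻ aq₂⁻ = refl
arc-unique q₁u₂⁺ q₁u₂⁺ = refl
arc-unique q₁u₂⁻ q₁u₂⁻ = refl
arc-unique q₂u₂⁺ q₂u₂⁺ = refl
arc-unique q₂u₂⁻ q₂u₂⁻ = refl
arc-unique (legˡ⁺ {p = p}) legʳ⁺ = ⊥-elim (Finₚ.<-irrefl refl p)
arc-unique (legʳ⁺ {p = p}) legˡ⁺ = ⊥-elim (Finₚ.<-irrefl refl p)
arc-unique (legˡ⁻ {p = p}) legʳ⁻ = ⊥-elim (Finₚ.<-irrefl refl p)
arc-unique (legʳ⁻ {p = p}) legˡ⁻ = ⊥-elim (Finₚ.<-irrefl refl p)

forcedGadget-noParallelEdges : ∀ c → NoParallelEdges {ForcedGadget c}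
forcedGadget-noParallelEdges c j j′ = arc-unique (arc {c} j) (arc {c} j′)

module _ {c : ℕ} {L : Labeling (ForcedGadget c)} (good : Good (ForcedGadget c) L) where
  private
    F : Graph
    F = ForcedGadget c

  spoke-labels-distinct : ∀ {i j : Fin (c ∸ 1)} → i Fin.< j → L (spoke i) ≢ L (spoke j)
  spoke-labels-distinct {i} {j} i<j = good⇒no-level-cherry good via-hub via-mid (λ ())
    where
      arm-i≢arm-j : arm {c ∸ 1} i ≢ arm j
      arm-i≢arm-j refl = Finₚ.<-irrefl refl i<j

      via-hub : Cherry {F} (arm i) hub (arm j) (spoke i) (spoke j)
      via-hub = cherry (inj₂ refl) (inj₁ refl) (λ ()) arm-i≢arm-j (λ ())

      via-mid : Cherry {F} (arm i) (mid i j i<j) (arm j) (legˡ i j i<j) (legʳ i j i<j)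
      via-mid = cherry (inj₁ refl) (inj₂ refl) (λ ()) arm-i≢arm-j (λ ())

  module _ (i : Fin (c ∸ 1)) (h : 1 ≤ toℕ i) where
    private
      a : FV (c ∸ 1)
      a = gad i h ga

      a-q₁-u₂ : Cherry {F} a (gad i h gq₁) (arm i) (gadE i h aq₁) (gadE i h q₁u₂)
      a-q₁-u₂ = cherry (inj₁ refl) (inj₁ refl) (λ ()) (λ ()) (λ ())

      a-q₂-u₂ : Cherry {F} a (gad i h gq₂) (arm i) (gadE i h aq₂) (gadE i h q₂u₂)
      a-q₂-u₂ = cherry (inj₁ refl) (inj₁ refl) (λ ()) (λ ()) (λ ())

      a-p₁-u₁ : Cherry {F} a (gad i h gp₁) hub (gadE i h ap₁) (gadE i h p₁u₁)
      a-p₁-u₁ = cherry (inj₁ refl) (inj₁ refl) (λ ()) (λ ()) (λ ())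

      a-p₂-u₁ : Cherry {F} a (gad i h gp₂) hub (gadE i h ap₂) (gadE i h p₂u₁)
      a-p₂-u₁ = cherry (inj₁ refl) (inj₁ refl) (λ ()) (λ ()) (λ ())

      no-rising-detour-from-bone : ∀ {q p e f e′ f′} →
        Cherry {F} a q (arm i) e f → Cherry {F} a p hub e′ f′ → hub ≢ q → p ≢ arm i →
        L (spoke i) ≤ L f → L f ≤ L e → L f′ ≤ L e′ → ⊥
      no-rising-detour-from-bone aqu apu hub≢q p≢arm b≤f f≤e f′≤e′ =
        p≢arm (good⇒firstHop-unique good (cherry-walk (cherry-reverse apu)) detour
                 (cherry-isPath (cherry-reverse apu)) detour-isPath (f′≤e′ ∷ [-]) (b≤f ∷ f≤e ∷ [-]))
        where
          detour : Walk F hub a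
          detour = step hub (spoke i) (arm i) (inj₁ refl) (cherry-walk (cherry-reverse aqu))

          detour-isPath : IsPath F detour
          detour-isPath = ((λ ()) ∷ hub≢q ∷ (λ ()) ∷ []) ∷ cherry-isPath (cherry-reverse aqu)

      no-rising-detour-to-bone : ∀ {q p e f e′ f′} →
        Cherry {F} a q (arm i) e f → Cherry {F} a p hub e′ f′ → q ≢ hub → q ≢ p →
        L e ≤ L f → L f ≤ L (spoke i) → L e′ ≤ L f′ → ⊥
      no-rising-detour-to-bone {q} {e = e} {f} aqu apu q≢hub q≢p e≤f f≤b e′≤f′ =
        q≢p (good⇒firstHop-unique good detour (cherry-walk apu)
               detour-isPath (cherry-isPath apu) (e≤f ∷ f≤b ∷ [-]) (e′≤f′ ∷ [-]))
        where
          open Cherry aqu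

          detour : Walk F a hub
          detour = step a e q x─m (step q f (arm i) m─y (step (arm i) (spoke i) hub (inj₂ refl) ([] hub)))

          detour-isPath : IsPath F detour
          detour-isPath = (x≢m ∷ x≢y ∷ (λ ()) ∷ []) ∷ (m≢y ∷ q≢hub ∷ []) ∷ ((λ ()) ∷ []) ∷ [] ∷ []

    bone-not-lowest : L (spoke i) ≤ L (gadE i h q₁u₂) → L (spoke i) ≤ L (gadE i h q₂u₂) → ⊥
    bone-not-lowest b≤₁ b≤₂
      with good⇒falling-cherry good a-q₁-u₂ a-q₂-u₂ (λ ())
         | good⇒falling-cherry good a-p₁-u₁ a-p₂-u₁ (λ ())
    ... | inj₁ q↓ | inj₁ p↓ = no-rising-detour-from-bone a-q₁-u₂ a-p₁-u₁ (λ ()) (λ ()) b≤₁ q↓ p↓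
    ... | inj₁ q↓ | inj₂ p↓ = no-rising-detour-from-bone a-q₁-u₂ a-p₂-u₁ (λ ()) (λ ()) b≤₁ q↓ p↓
    ... | inj₂ q↓ | inj₁ p↓ = no-rising-detour-from-bone a-q₂-u₂ a-p₁-u₁ (λ ()) (λ ()) b≤₂ q↓ p↓
    ... | inj₂ q↓ | inj₂ p↓ = no-rising-detour-from-bone a-q₂-u₂ a-p₂-u₁ (λ ()) (λ ()) b≤₂ q↓ p↓

    bone-not-highest : L (gadE i h q₁u₂) ≤ L (spoke i) → L (gadE i h q₂u₂) ≤ L (spoke i) → ⊥
    bone-not-highest ₁≤b ₂≤b
      with good⇒falling-cherry good (cherry-reverse a-q₁-u₂) (cherry-reverse a-q₂-u₂) (λ ())
         | good⇒falling-cherry good (cherry-reverse a-p₁-u₁) (cherry-reverse a-p₂-u₁) (λ ())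
    ... | inj₁ q↑ | inj₁ p↑ = no-rising-detour-to-bone a-q₁-u₂ a-p₁-u₁ (λ ()) (λ ()) q↑ ₁≤b p↑
    ... | inj₁ q↑ | inj₂ p↑ = no-rising-detour-to-bone a-q₁-u₂ a-p₂-u₁ (λ ()) (λ ()) q↑ ₁≤b p↑
    ... | inj₂ q↑ | inj₁ p↑ = no-rising-detour-to-bone a-q₂-u₂ a-p₁-u₁ (λ ()) (λ ()) q↑ ₂≤b p↑
    ... | inj₂ q↑ | inj₂ p↑ = no-rising-detour-to-bone a-q₂-u₂ a-p₂-u₁ (λ ()) (λ ()) q↑ ₂≤b p↑

    gadget-spoke-label-inside : ValuesIn1to F c L → 2 ≤ L (spoke i) × L (spoke i) < c
    gadget-spoke-label-inside range = ℕₚ.≰⇒> not-lowest , ℕₚ.≰⇒> not-highest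
      where
        not-lowest : ¬ L (spoke i) ≤ 1
        not-lowest b≤1 = bone-not-lowest (≤-trans b≤1 (proj₁ (range _)))
                                         (≤-trans b≤1 (proj₁ (range _)))

        not-highest : ¬ c ≤ L (spoke i)
        not-highest c≤b = bone-not-highest (≤-trans (proj₂ (range _)) c≤b)
                                           (≤-trans (proj₂ (range _)) c≤b)

module _ (k : ℕ) (L : Labeling (ForcedGadget (3 + k)))
         (range : ValuesIn1to (ForcedGadget (3 + k)) (3 + k) L)
         (good : Good (ForcedGadget (3 + k)) L) where

  spoke-labels-inside : L (spoke Fin.zero) ≢ 1 → L (spoke Fin.zero) ≢ 3 + k →
                        ∀ i → 2 ≤ L (spoke i) × L (spoke i) < 3 + k
  spoke-labels-inside b≢1 b≢c Fin.zero =
    ℕₚ.≤∧≢⇒< (proj₁ (range _)) (b≢1 ∘ sym) , ℕₚ.≤∧≢⇒< (proj₂ (range _)) b≢c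
  spoke-labels-inside _ _ i@(Fin.suc _) = gadget-spoke-label-inside good i (s≤s z≤n) range

  bone-label-extreme : L (spoke Fin.zero) ≡ 1 ⊎ L (spoke Fin.zero) ≡ 3 + k
  bone-label-extreme with L (spoke Fin.zero) ≟ 1 | L (spoke Fin.zero) ≟ 3 + k
  ... | yes b≡1 | _       = inj₁ b≡1
  ... | no _    | yes b≡c = inj₂ b≡c
  ... | no b≢1  | no b≢c
    with i , j , i<j , same ← pigeonhole-interval (L ∘ spoke) (spoke-labels-inside b≢1 b≢c)
    = ⊥-elim (spoke-labels-distinct {3 + k} good i<j same)

module Canonical (n : ℕ) where
  d top : ℕ
  d = suc n
  top = suc d

  F : Graph
  F = ForcedGadget top

  index : Fin d → ℕ
  index i = suc (toℕ i)

  label : FE d → ℕ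
  label (spoke i)         = index i
  label (legˡ _ _ _)      = top
  label (legʳ _ _ _)      = 1
  label (gadE _ _ ap₁)    = 1
  label (gadE _ _ ap₂)    = top
  label (gadE _ _ p₁u₁)   = top
  label (gadE _ _ p₂u₁)   = 1
  label (gadE _ _ aq₁)    = 1
  label (gadE _ _ aq₂)    = top
  label (gadE _ _ q₁u₂)   = top
  label (gadE _ _ q₂u₂)   = 1

  index<top : ∀ i → index i < top
  index<top i = s≤s (Finₚ.toℕ<n i)

  label-range : ValuesIn1to F top label
  label-range (spoke i)       = s≤s z≤n , ℕₚ.<⇒≤ (index<top i)
  label-range (legˡ _ _ _)    = s≤s z≤n , ≤-refl
  label-range (legʳ _ _ _)    = s≤s z≤n , s≤s z≤n
  label-range (gadE _ _ ap₁)  = s≤s z≤n , s≤s z≤n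
  label-range (gadE _ _ ap₂)  = s≤s z≤n , ≤-refl
  label-range (gadE _ _ p₁u₁) = s≤s z≤n , ≤-refl
  label-range (gadE _ _ p₂u₁) = s≤s z≤n , s≤s z≤n
  label-range (gadE _ _ aq₁)  = s≤s z≤n , s≤s z≤n
  label-range (gadE _ _ aq₂)  = s≤s z≤n , ≤-refl
  label-range (gadE _ _ q₁u₂) = s≤s z≤n , ≤-refl
  label-range (gadE _ _ q₂u₂) = s≤s z≤n , s≤s z≤n

  top≰1 : ¬ top ≤ 1
  top≰1 (s≤s ())

  index≰1 : ∀ {j} → 1 ≤ toℕ j → ¬ index j ≤ 1
  index≰1 1≤j (s≤s j≤0) = ℕₚ.<⇒≱ 1≤j j≤0

  V : Set
  V = FV d

  highStar : V → V
  highStar hub            = hub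
  highStar (arm i)        = arm i
  highStar (mid i _ _)    = arm i
  highStar (gad k h ga)   = gad k h ga
  highStar (gad _ _ gp₁)  = hub
  highStar (gad k h gp₂)  = gad k h ga
  highStar (gad k _ gq₁)  = arm k
  highStar (gad k h gq₂)  = gad k h ga

  high-arc-keeps-star : ∀ {w w′ f} → Arc w w′ f → top ≤ label f → highStar w′ ≡ highStar w
  high-arc-keeps-star (spoke⁺ {i}) top≤ = ⊥-elim (ℕₚ.<⇒≱ (index<top i) top≤)
  high-arc-keeps-star (spoke⁻ {i}) top≤ = ⊥-elim (ℕₚ.<⇒≱ (index<top i) top≤)
  high-arc-keeps-star legˡ⁺ _ = refl
  high-arc-keeps-star legˡ⁻ _ = refl
  high-arc-keeps-star legʳ⁺ top≤ = ⊥-elim (top≰1 top≤)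
  high-arc-keeps-star legʳ⁻ top≤ = ⊥-elim (top≰1 top≤)
  high-arc-keeps-star ap₁⁺ top≤ = ⊥-elim (top≰1 top≤)
  high-arc-keeps-star ap₁⁻ top≤ = ⊥-elim (top≰1 top≤)
  high-arc-keeps-star ap₂⁺ _ = refl
  high-arc-keeps-star ap₂⁻ _ = refl
  high-arc-keeps-star p₁u₁⁺ _ = refl
  high-arc-keeps-star p₁u₁⁻ _ = refl
  high-arc-keeps-star p₂u₁⁺ top≤ = ⊥-elim (top≰1 top≤)
  high-arc-keeps-star p₂u₁⁻ top≤ = ⊥-elim (top≰1 top≤)
  high-arc-keeps-star aq₁⁺ top≤ = ⊥-elim (top≰1 top≤)
  high-arc-keeps-star aq₁⁻ top≤ = ⊥-elim (top≰1 top≤)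
  high-arc-keeps-star aq₂⁺ _ = refl
  high-arc-keeps-star aq₂⁻ _ = refl
  high-arc-keeps-star q₁u₂⁺ _ = refl
  high-arc-keeps-star q₁u₂⁻ _ = refl
  high-arc-keeps-star q₂u₂⁺ top≤ = ⊥-elim (top≰1 top≤)
  high-arc-keeps-star q₂u₂⁻ top≤ = ⊥-elim (top≰1 top≤)

  mid-irrelevant : ∀ {i j} {p q : i Fin.< j} → mid {d} i j p ≡ mid i j q
  mid-irrelevant {p = p} {q} = cong (mid _ _) (ℕₚ.<-irrelevant p q)

  gad-irrelevant : ∀ {k} {h h′ : 1 ≤ toℕ k} {g} → gad {d} k h g ≡ gad k h′ g
  gad-irrelevant {h = h} {h′} = cong (λ h″ → gad _ h″ _) (ℕₚ.≤-irrelevant h h′)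

  data HighLeaf : V → V → Set where
    lfP1 : ∀ {k h} → HighLeaf hub (gad k h gp₁)
    lfMid : ∀ {i j p} → HighLeaf (arm i) (mid i j p)
    lfQ1 : ∀ {k h} → HighLeaf (arm k) (gad k h gq₁)
    lfP2 : ∀ {k h} → HighLeaf (gad k h ga) (gad k h gp₂)
    lfQ2 : ∀ {k h} → HighLeaf (gad k h ga) (gad k h gq₂)

  -- The relations Enters… x z describe where an increasing path from x with first hop z
  -- (never returning to x) can get: EntersHigh the label-top stars (by their centre) it
  -- can enter, EntersHub a lower bound for the label on which it can arrive at the hub,
  -- and the others the vertices it can reach before using a label-top edge. Constructor
  -- names abbreviate the start x and, where needed, the first hop and the target.
  data EntersHigh : V → V → V → Set where
    hiHubP2 : ∀ {k h} → EntersHigh hub (gad k h gp₂) (gad k h ga)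
    hiHubA : ∀ {i} → EntersHigh hub (arm i) (arm i)
    hiArmMid : ∀ {k i} (p : k Fin.< i) → EntersHigh (arm i) (mid k i p) (arm k)
    hiArmQ2 : ∀ {i h} → EntersHigh (arm i) (gad i h gq₂) (gad i h ga)
    hiArmHub : ∀ {i} → EntersHigh (arm i) hub hub
    hiArmHubA : ∀ {i j} → i Fin.< j → EntersHigh (arm i) hub (arm j)
    hiArmHubG : ∀ {m h} → EntersHigh (arm Fin.zero) hub (gad m h ga)
    hiMidL : ∀ {i j p} → EntersHigh (mid i j p) (arm i) (arm i)
    hiMidR : ∀ {i j p k} → k ≢ i → EntersHigh (mid i j p) (arm j) (arm k)
    hiMidRH : ∀ {i j p} → EntersHigh (mid i j p) (arm j) hub
    hiMidRG : ∀ {i j p h} → EntersHigh (mid i j p) (arm j) (gad j h ga)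
    hiAP1 : ∀ {k h} → EntersHigh (gad k h ga) (gad k h gp₁) hub
    hiAQ1 : ∀ {k h} → EntersHigh (gad k h ga) (gad k h gq₁) (arm k)
    hiP1H : ∀ {k h} → EntersHigh (gad k h gp₁) hub hub
    hiP1A : ∀ {k h} → EntersHigh (gad k h gp₁) (gad k h ga) (gad k h ga)
    hiP1Arm : ∀ {k h} → EntersHigh (gad k h gp₁) (gad k h ga) (arm k)
    hiP2A : ∀ {k h} → EntersHigh (gad k h gp₂) (gad k h ga) (gad k h ga)
    hiP2H : ∀ {k h} → EntersHigh (gad k h gp₂) hub hub
    hiP2Arm : ∀ {k h j} → EntersHigh (gad k h gp₂) hub (arm j)
    hiP2G : ∀ {k h m h′} → m ≢ k → EntersHigh (gad k h gp₂) hub (gad m h′ ga)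
    hiQ1Arm : ∀ {k h} → EntersHigh (gad k h gq₁) (arm k) (arm k)
    hiQ1H : ∀ {k h} → EntersHigh (gad k h gq₁) (gad k h ga) hub
    hiQ1A : ∀ {k h} → EntersHigh (gad k h gq₁) (gad k h ga) (gad k h ga)
    hiQ2A : ∀ {k h} → EntersHigh (gad k h gq₂) (gad k h ga) (gad k h ga)
    hiQ2Arm : ∀ {k h m} → EntersHigh (gad k h gq₂) (arm k) (arm m)
    hiQ2H : ∀ {k h} → EntersHigh (gad k h gq₂) (arm k) hub

  data EntersHub : V → V → ℕ → Set where
    hbArm : ∀ {i} → EntersHub (arm i) hub (index i)
    hbMid : ∀ {i j p} → EntersHub (mid i j p) (arm j) (index j)
    hbP2 : ∀ {k h} → EntersHub (gad k h gp₂) hub 0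
    hbQ2 : ∀ {k h} → EntersHub (gad k h gq₂) (arm k) (index k)

  data EntersArmBySpoke : V → V → Fin d → Set where
    saHub : ∀ {i} → EntersArmBySpoke hub (arm i) i
    saArm : ∀ {i j} → i Fin.< j → EntersArmBySpoke (arm i) hub j
    saMid : ∀ {i j p m} → j Fin.≤ m → EntersArmBySpoke (mid i j p) (arm j) m
    saP2 : ∀ {k h j} → EntersArmBySpoke (gad k h gp₂) hub j
    saQ2 : ∀ {k h j} → k Fin.≤ j → EntersArmBySpoke (gad k h gq₂) (arm k) j

  data EntersP₂ : V → V → (m : Fin d) → 1 ≤ toℕ m → Set where
    p2Hub : ∀ {k h} → EntersP₂ hub (gad k h gp₂) k h
    p2Arm : ∀ {m h} → EntersP₂ (arm Fin.zero) hub m h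
    p2P2 : ∀ {k h m h′} → m ≢ k → EntersP₂ (gad k h gp₂) hub m h′

  data EntersMid : V → V → Fin d → Fin d → Set where
    mdArm : ∀ {k i} (p : k Fin.< i) → EntersMid (arm i) (mid k i p) k i
    mdMid : ∀ {i j p k} → k ≢ i → EntersMid (mid i j p) (arm j) k j
    mdQ2 : ∀ {k h m} → EntersMid (gad k h gq₂) (arm k) m k

  data EntersArmLow : V → V → Fin d → Set where
    laMid : ∀ {i j p} → EntersArmLow (mid i j p) (arm j) j
    laQ2 : ∀ {k h} → EntersArmLow (gad k h gq₂) (arm k) k

  data EntersQ₂ : V → V → (m : Fin d) → 1 ≤ toℕ m → Set where
    q2Arm : ∀ {i h} → EntersQ₂ (arm i) (gad i h gq₂) i h
    q2Mid : ∀ {i j p h} → EntersQ₂ (mid i j p) (arm j) j h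

  data EntersP₁ : V → V → (m : Fin d) → 1 ≤ toℕ m → Set where
    p1A : ∀ {k h} → EntersP₁ (gad k h ga) (gad k h gp₁) k h
    p1Q1 : ∀ {k h} → EntersP₁ (gad k h gq₁) (gad k h ga) k h

  data EntersQ₁ : V → V → (m : Fin d) → 1 ≤ toℕ m → Set where
    q1A : ∀ {k h} → EntersQ₁ (gad k h ga) (gad k h gq₁) k h
    q1P1 : ∀ {k h} → EntersQ₁ (gad k h gp₁) (gad k h ga) k h

  data EntersA : V → V → (m : Fin d) → 1 ≤ toℕ m → Set where
    aP1 : ∀ {k h} → EntersA (gad k h gp₁) (gad k h ga) k h
    aQ1 : ∀ {k h} → EntersA (gad k h gq₁) (gad k h ga) k h

  data Reach (x z : V) : V → ℕ → Set where
    at-leaf : ∀ {ℓ} → HighLeaf x z → top ≤ ℓ → Reach x z z ℓ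
    in-high-star : ∀ {w s ℓ} → EntersHigh x z s → highStar w ≡ s → top ≤ ℓ → Reach x z w ℓ
    at-hub : ∀ {t ℓ} → EntersHub x z t → t ≤ ℓ → Reach x z hub ℓ
    at-arm-by-spoke : ∀ {j ℓ} → EntersArmBySpoke x z j → index j ≤ ℓ → Reach x z (arm j) ℓ
    at-p₂ : ∀ {m h ℓ} → EntersP₂ x z m h → Reach x z (gad m h gp₂) ℓ
    at-mid : ∀ {k j p ℓ} → EntersMid x z k j → Reach x z (mid k j p) ℓ
    at-arm-low : ∀ {j ℓ} → EntersArmLow x z j → Reach x z (arm j) ℓ
    at-q₂ : ∀ {m h ℓ} → EntersQ₂ x z m h → Reach x z (gad m h gq₂) ℓ
    at-p₁ : ∀ {m h ℓ} → EntersP₁ x z m h → Reach x z (gad m h gp₁) ℓ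
    at-q₁ : ∀ {m h ℓ} → EntersQ₁ x z m h → Reach x z (gad m h gq₁) ℓ
    at-a : ∀ {m h ℓ} → EntersA x z m h → Reach x z (gad m h ga) ℓ

  p₂⇒hub : ∀ {x z m h} → EntersP₂ x z m h → x ≢ hub → ∃ λ t → EntersHub x z t × t ≤ 1
  p₂⇒hub p2Hub ne = ⊥-elim (ne refl)
  p₂⇒hub p2Arm _ = 1 , hbArm , ≤-refl
  p₂⇒hub (p2P2 _) _ = 0 , hbP2 , z≤n

  p₂⇒high : ∀ {x z m h} → EntersP₂ x z m h → EntersHigh x z (gad m h ga)
  p₂⇒high p2Hub = hiHubP2
  p₂⇒high p2Arm = hiArmHubG
  p₂⇒high (p2P2 ne) = hiP2G ne

  mid⇒high : ∀ {x z k j} → EntersMid x z k j → x ≢ arm k → EntersHigh x z (arm k)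
  mid⇒high (mdArm p) _ = hiArmMid p
  mid⇒high (mdMid ki) _ = hiMidR ki
  mid⇒high mdQ2 _ = hiQ2Arm

  mid⇒armLow : ∀ {x z k j} → EntersMid x z k j → x ≢ arm j → EntersArmLow x z j
  mid⇒armLow (mdArm _) ne = ⊥-elim (ne refl)
  mid⇒armLow (mdMid _) _ = laMid
  mid⇒armLow mdQ2 _ = laQ2

  armLow⇒hub : ∀ {x z j} → EntersArmLow x z j → ∃ λ t → EntersHub x z t × t ≤ index j
  armLow⇒hub laMid = _ , hbMid , ≤-refl
  armLow⇒hub laQ2 = _ , hbQ2 , ≤-refl

  armLow⇒high : ∀ {x z j} → EntersArmLow x z j → EntersHigh x z (arm j)
  armLow⇒high (laMid {p = p}) = hiMidR (λ e → Finₚ.<-irrefl (sym e) p)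
  armLow⇒high laQ2 = hiQ2Arm

  armLow⇒mid : ∀ {x z k j p} → EntersArmLow x z j → x ≢ mid k j p → EntersMid x z k j
  armLow⇒mid laMid ne = mdMid (λ { refl → ne mid-irrelevant })
  armLow⇒mid laQ2 _ = mdQ2

  armLow⇒q₂ : ∀ {x z j h} → EntersArmLow x z j → x ≢ gad j h gq₂ → EntersQ₂ x z j h
  armLow⇒q₂ laMid _ = q2Mid
  armLow⇒q₂ laQ2 ne = ⊥-elim (ne gad-irrelevant)

  q₂⇒high : ∀ {x z m h} → EntersQ₂ x z m h → EntersHigh x z (gad m h ga)
  q₂⇒high q2Arm = hiArmQ2
  q₂⇒high q2Mid = hiMidRG

  q₂⇒armLow : ∀ {x z m h} → EntersQ₂ x z m h → x ≢ arm m → EntersArmLow x z m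
  q₂⇒armLow q2Arm ne = ⊥-elim (ne refl)
  q₂⇒armLow q2Mid _ = laMid

  p₁⇒a : ∀ {x z m h} → EntersP₁ x z m h → x ≢ gad m h ga → EntersA x z m h
  p₁⇒a p1A ne = ⊥-elim (ne refl)
  p₁⇒a p1Q1 _ = aQ1

  p₁⇒high : ∀ {x z m h} → EntersP₁ x z m h → EntersHigh x z hub
  p₁⇒high p1A = hiAP1
  p₁⇒high p1Q1 = hiQ1H

  q₁⇒a : ∀ {x z m h} → EntersQ₁ x z m h → x ≢ gad m h ga → EntersA x z m h
  q₁⇒a q1A ne = ⊥-elim (ne refl)
  q₁⇒a q1P1 _ = aP1

  q₁⇒high : ∀ {x z m h} → EntersQ₁ x z m h → EntersHigh x z (arm m)
  q₁⇒high q1A = hiAQ1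
  q₁⇒high q1P1 = hiP1Arm

  a⇒p₁ : ∀ {x z m h} → EntersA x z m h → x ≢ gad m h gp₁ → EntersP₁ x z m h
  a⇒p₁ aP1 ne = ⊥-elim (ne refl)
  a⇒p₁ aQ1 _ = p1Q1

  a⇒q₁ : ∀ {x z m h} → EntersA x z m h → x ≢ gad m h gq₁ → EntersQ₁ x z m h
  a⇒q₁ aP1 _ = q1P1
  a⇒q₁ aQ1 ne = ⊥-elim (ne refl)

  a⇒high : ∀ {x z m h} → EntersA x z m h → EntersHigh x z (gad m h ga)
  a⇒high aP1 = hiP1A
  a⇒high aQ1 = hiQ1A

  hub⇒armBySpoke : ∀ {x z t j} → EntersHub x z t → t ≤ index j → x ≢ arm j → EntersArmBySpoke x z j
  hub⇒armBySpoke hbArm le ne = saArm (Finₚ.≤∧≢⇒< (ℕₚ.≤-pred le) (λ { refl → ne refl }))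
  hub⇒armBySpoke hbMid le _ = saMid (ℕₚ.≤-pred le)
  hub⇒armBySpoke hbP2 _ _ = saP2
  hub⇒armBySpoke hbQ2 le _ = saQ2 (ℕₚ.≤-pred le)

  hub⇒high : ∀ {x z t} → EntersHub x z t → EntersHigh x z hub
  hub⇒high hbArm = hiArmHub
  hub⇒high hbMid = hiMidRH
  hub⇒high hbP2 = hiP2H
  hub⇒high hbQ2 = hiQ2H

  hub⇒p₂ : ∀ {x z t m h} → EntersHub x z t → t ≤ 1 → x ≢ gad m h gp₂ → EntersP₂ x z m h
  hub⇒p₂ (hbArm {Fin.zero}) _ _ = p2Arm
  hub⇒p₂ (hbArm {Fin.suc i}) (s≤s ()) ne
  hub⇒p₂ (hbMid {Fin.zero} {Fin.zero} {()}) le ne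
  hub⇒p₂ (hbMid {_} {Fin.suc j}) (s≤s ()) ne
  hub⇒p₂ hbP2 _ ne = p2P2 (λ { refl → ne gad-irrelevant })
  hub⇒p₂ (hbQ2 {h = h}) le _ = ⊥-elim (index≰1 h le)

  armBySpoke⇒hub : ∀ {x z j} → EntersArmBySpoke x z j → x ≢ hub → ∃ λ t → EntersHub x z t × t ≤ index j
  armBySpoke⇒hub saHub ne = ⊥-elim (ne refl)
  armBySpoke⇒hub (saArm lt) _ = _ , hbArm , ℕₚ.<⇒≤ (s≤s lt)
  armBySpoke⇒hub (saMid le) _ = _ , hbMid , s≤s le
  armBySpoke⇒hub saP2 _ = 0 , hbP2 , z≤n
  armBySpoke⇒hub (saQ2 le) _ = _ , hbQ2 , s≤s le

  armBySpoke⇒high : ∀ {x z j} → EntersArmBySpoke x z j → EntersHigh x z (arm j)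
  armBySpoke⇒high saHub = hiHubA
  armBySpoke⇒high (saArm lt) = hiArmHubA lt
  armBySpoke⇒high (saMid {p = p} le) = hiMidR (λ { refl → ℕₚ.<-irrefl refl (ℕₚ.<-≤-trans p le) })
  armBySpoke⇒high saP2 = hiP2Arm
  armBySpoke⇒high (saQ2 _) = hiQ2Arm


  hop-high : ∀ {x z z′ s} → EntersHigh x z s → EntersHigh x z′ s → z ≡ z′
  hop-high hiHubP2 hiHubP2 = refl
  hop-high hiHubA hiHubA = refl
  hop-high (hiArmMid _) (hiArmMid _) = mid-irrelevant
  hop-high (hiArmMid p) (hiArmHubA q) = ⊥-elim (Finₚ.<-asym p q)
  hop-high (hiArmHubA q) (hiArmMid p) = ⊥-elim (Finₚ.<-asym p q)
  hop-high hiArmQ2 hiArmQ2 = refl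
  hop-high (hiArmQ2 {h = ()}) hiArmHubG
  hop-high hiArmHubG (hiArmQ2 {h = ()})
  hop-high hiArmHub hiArmHub = refl
  hop-high (hiArmHubA _) (hiArmHubA _) = refl
  hop-high hiArmHubG hiArmHubG = refl
  hop-high hiMidL hiMidL = refl
  hop-high hiMidL (hiMidR ne) = ⊥-elim (ne refl)
  hop-high (hiMidR ne) hiMidL = ⊥-elim (ne refl)
  hop-high (hiMidR _) (hiMidR _) = refl
  hop-high hiMidRH hiMidRH = refl
  hop-high hiMidRG hiMidRG = refl
  hop-high hiAP1 hiAP1 = refl
  hop-high hiAQ1 hiAQ1 = refl
  hop-high hiP1H hiP1H = refl
  hop-high hiP1A hiP1A = refl
  hop-high hiP1Arm hiP1Arm = refl
  hop-high hiP2A hiP2A = refl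
  hop-high hiP2A (hiP2G ne) = ⊥-elim (ne refl)
  hop-high (hiP2G ne) hiP2A = ⊥-elim (ne refl)
  hop-high hiP2H hiP2H = refl
  hop-high hiP2Arm hiP2Arm = refl
  hop-high (hiP2G _) (hiP2G _) = refl
  hop-high hiQ1Arm hiQ1Arm = refl
  hop-high hiQ1H hiQ1H = refl
  hop-high hiQ1A hiQ1A = refl
  hop-high hiQ2A hiQ2A = refl
  hop-high hiQ2Arm hiQ2Arm = refl
  hop-high hiQ2H hiQ2H = refl

  high-not-own-star : ∀ {x z} → EntersHigh x z x → ⊥
  high-not-own-star (hiArmMid p) = Finₚ.<-irrefl refl p
  high-not-own-star (hiArmHubA lt) = Finₚ.<-irrefl refl lt

  leaf-star : ∀ {x w} → HighLeaf x w → highStar w ≡ x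
  leaf-star lfP1 = refl
  leaf-star lfMid = refl
  leaf-star lfQ1 = refl
  leaf-star lfP2 = refl
  leaf-star lfQ2 = refl

  hop-hub : ∀ {x z z′ t t′} → EntersHub x z t → EntersHub x z′ t′ → z ≡ z′
  hop-hub hbArm hbArm = refl
  hop-hub hbMid hbMid = refl
  hop-hub hbP2 hbP2 = refl
  hop-hub hbQ2 hbQ2 = refl

  hop-armBySpoke : ∀ {x z z′ j} → EntersArmBySpoke x z j → EntersArmBySpoke x z′ j → z ≡ z′
  hop-armBySpoke saHub saHub = refl
  hop-armBySpoke (saArm _) (saArm _) = refl
  hop-armBySpoke (saMid _) (saMid _) = refl
  hop-armBySpoke saP2 saP2 = refl
  hop-armBySpoke (saQ2 _) (saQ2 _) = refl

  hop-p₂ : ∀ {x z z′ m h} → EntersP₂ x z m h → EntersP₂ x z′ m h → z ≡ z′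
  hop-p₂ p2Hub p2Hub = refl
  hop-p₂ p2Arm p2Arm = refl
  hop-p₂ (p2P2 _) (p2P2 _) = refl

  hop-mid : ∀ {x z z′ k j} → EntersMid x z k j → EntersMid x z′ k j → z ≡ z′
  hop-mid (mdArm _) (mdArm _) = mid-irrelevant
  hop-mid (mdMid _) (mdMid _) = refl
  hop-mid mdQ2 mdQ2 = refl

  hop-armLow : ∀ {x z z′ j} → EntersArmLow x z j → EntersArmLow x z′ j → z ≡ z′
  hop-armLow laMid laMid = refl
  hop-armLow laQ2 laQ2 = refl

  hop-q₂ : ∀ {x z z′ m h} → EntersQ₂ x z m h → EntersQ₂ x z′ m h → z ≡ z′
  hop-q₂ q2Arm q2Arm = refl
  hop-q₂ q2Mid q2Mid = refl

  hop-p₁ : ∀ {x z z′ m h} → EntersP₁ x z m h → EntersP₁ x z′ m h → z ≡ z′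
  hop-p₁ p1A p1A = refl
  hop-p₁ p1Q1 p1Q1 = refl

  hop-q₁ : ∀ {x z z′ m h} → EntersQ₁ x z m h → EntersQ₁ x z′ m h → z ≡ z′
  hop-q₁ q1A q1A = refl
  hop-q₁ q1P1 q1P1 = refl

  hop-a : ∀ {x z z′ m h} → EntersA x z m h → EntersA x z′ m h → z ≡ z′
  hop-a aP1 aP1 = refl
  hop-a aQ1 aQ1 = refl

  hop-high-hub : ∀ {x z z′ t} → EntersHigh x z hub → EntersHub x z′ t → z ≡ z′
  hop-high-hub hiArmHub hbArm = refl
  hop-high-hub hiMidRH hbMid = refl
  hop-high-hub hiP2H hbP2 = refl
  hop-high-hub hiQ2H hbQ2 = refl

  hop-high-armBySpoke : ∀ {x z z′ j} → EntersHigh x z (arm j) → EntersArmBySpoke x z′ j → z ≡ z′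
  hop-high-armBySpoke hiHubA saHub = refl
  hop-high-armBySpoke (hiArmMid p) (saArm lt) = ⊥-elim (Finₚ.<-asym p lt)
  hop-high-armBySpoke (hiArmHubA _) (saArm _) = refl
  hop-high-armBySpoke (hiMidL {p = p}) (saMid le) = ⊥-elim (ℕₚ.<-irrefl refl (ℕₚ.<-≤-trans p le))
  hop-high-armBySpoke (hiMidR _) (saMid _) = refl
  hop-high-armBySpoke hiP2Arm saP2 = refl
  hop-high-armBySpoke hiQ2Arm (saQ2 _) = refl

  hop-high-armLow : ∀ {x z z′ j} → EntersHigh x z (arm j) → EntersArmLow x z′ j → z ≡ z′
  hop-high-armLow (hiMidL {p = p}) laMid = ⊥-elim (Finₚ.<-irrefl refl p)
  hop-high-armLow (hiMidR _) laMid = refl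
  hop-high-armLow hiQ2Arm laQ2 = refl

  hop-armBySpoke-armLow : ∀ {x z z′ j} → EntersArmBySpoke x z j → EntersArmLow x z′ j → z ≡ z′
  hop-armBySpoke-armLow (saMid _) laMid = refl
  hop-armBySpoke-armLow (saQ2 _) laQ2 = refl

  hop-high-mid : ∀ {x z z′ k j} → EntersHigh x z (arm k) → EntersMid x z′ k j → z ≡ z′
  hop-high-mid (hiArmMid _) (mdArm _) = mid-irrelevant
  hop-high-mid (hiArmHubA lt) (mdArm p) = ⊥-elim (Finₚ.<-asym p lt)
  hop-high-mid hiMidL (mdMid ne) = ⊥-elim (ne refl)
  hop-high-mid (hiMidR _) (mdMid _) = refl
  hop-high-mid hiQ2Arm mdQ2 = refl

  hop-high-a : ∀ {x z z′ m h} → EntersHigh x z (gad m h ga) → EntersA x z′ m h → z ≡ z′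
  hop-high-a hiP1A aP1 = refl
  hop-high-a hiQ1A aQ1 = refl

  hop-high-p₁ : ∀ {x z z′ m h} → EntersHigh x z hub → EntersP₁ x z′ m h → z ≡ z′
  hop-high-p₁ hiAP1 p1A = refl
  hop-high-p₁ hiQ1H p1Q1 = refl

  hop-high-p₂ : ∀ {x z z′ m h} → EntersHigh x z (gad m h ga) → EntersP₂ x z′ m h → z ≡ z′
  hop-high-p₂ hiHubP2 p2Hub = refl
  hop-high-p₂ (hiArmQ2 {h = ()}) p2Arm
  hop-high-p₂ hiArmHubG p2Arm = refl
  hop-high-p₂ hiP2A (p2P2 ne) = ⊥-elim (ne refl)
  hop-high-p₂ (hiP2G _) (p2P2 _) = refl

  hop-high-q₁ : ∀ {x z z′ m h} → EntersHigh x z (arm m) → EntersQ₁ x z′ m h → z ≡ z′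
  hop-high-q₁ hiAQ1 q1A = refl
  hop-high-q₁ hiP1Arm q1P1 = refl

  hop-high-q₂ : ∀ {x z z′ m h} → EntersHigh x z (gad m h ga) → EntersQ₂ x z′ m h → z ≡ z′
  hop-high-q₂ hiArmQ2 q2Arm = refl
  hop-high-q₂ hiArmHubG (q2Arm {h = ()})
  hop-high-q₂ hiMidRG q2Mid = refl

  leaf-not-entered-high : ∀ {x z w} → HighLeaf x w → EntersHigh x z (highStar w) → ⊥
  leaf-not-entered-high l o = high-not-own-star (subst (EntersHigh _ _) (leaf-star l) o)

  leaf-not-mid : ∀ {x z′ k j p} → HighLeaf x (mid k j p) → EntersMid x z′ k j → ⊥
  leaf-not-mid (lfMid {p = p}) (mdArm _) = Finₚ.<-irrefl refl p

  reach-hop-unique : ∀ {x z z′ y ℓ ℓ′} → Reach x z y ℓ → Reach x z′ y ℓ′ → z ≡ z′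
  reach-hop-unique (at-leaf _ _) (at-leaf _ _) = refl
  reach-hop-unique (at-leaf l _) (in-high-star o refl _) = ⊥-elim (leaf-not-entered-high l o)
  reach-hop-unique (in-high-star o refl _) (at-leaf l _) = ⊥-elim (leaf-not-entered-high l o)
  reach-hop-unique (at-leaf l _) (at-mid o) = ⊥-elim (leaf-not-mid l o)
  reach-hop-unique (at-mid o) (at-leaf l _) = ⊥-elim (leaf-not-mid l o)
  reach-hop-unique (at-leaf lfP1 _) (at-p₁ ())
  reach-hop-unique (at-p₁ ()) (at-leaf lfP1 _)
  reach-hop-unique (at-leaf lfP2 _) (at-p₂ ())
  reach-hop-unique (at-p₂ ()) (at-leaf lfP2 _)
  reach-hop-unique (at-leaf lfQ1 _) (at-q₁ ())
  reach-hop-unique (at-q₁ ()) (at-leaf lfQ1 _)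
  reach-hop-unique (at-leaf lfQ2 _) (at-q₂ ())
  reach-hop-unique (at-q₂ ()) (at-leaf lfQ2 _)
  reach-hop-unique (in-high-star o e _) (in-high-star o′ e′ _) = hop-high o (subst (EntersHigh _ _) (trans (sym e′) e) o′)
  reach-hop-unique (in-high-star o refl _) (at-hub o′ _) = hop-high-hub o o′
  reach-hop-unique (at-hub o′ _) (in-high-star o refl _) = sym (hop-high-hub o o′)
  reach-hop-unique (in-high-star o refl _) (at-arm-by-spoke o′ _) = hop-high-armBySpoke o o′
  reach-hop-unique (at-arm-by-spoke o′ _) (in-high-star o refl _) = sym (hop-high-armBySpoke o o′)
  reach-hop-unique (in-high-star o refl _) (at-arm-low o′) = hop-high-armLow o o′
  reach-hop-unique (at-arm-low o′) (in-high-star o refl _) = sym (hop-high-armLow o o′)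
  reach-hop-unique (in-high-star o refl _) (at-mid o′) = hop-high-mid o o′
  reach-hop-unique (at-mid o′) (in-high-star o refl _) = sym (hop-high-mid o o′)
  reach-hop-unique (in-high-star o refl _) (at-a o′) = hop-high-a o o′
  reach-hop-unique (at-a o′) (in-high-star o refl _) = sym (hop-high-a o o′)
  reach-hop-unique (in-high-star o refl _) (at-p₁ o′) = hop-high-p₁ o o′
  reach-hop-unique (at-p₁ o′) (in-high-star o refl _) = sym (hop-high-p₁ o o′)
  reach-hop-unique (in-high-star o refl _) (at-p₂ o′) = hop-high-p₂ o o′
  reach-hop-unique (at-p₂ o′) (in-high-star o refl _) = sym (hop-high-p₂ o o′)
  reach-hop-unique (in-high-star o refl _) (at-q₁ o′) = hop-high-q₁ o o′
  reach-hop-unique (at-q₁ o′) (in-high-star o refl _) = sym (hop-high-q₁ o o′)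
  reach-hop-unique (in-high-star o refl _) (at-q₂ o′) = hop-high-q₂ o o′
  reach-hop-unique (at-q₂ o′) (in-high-star o refl _) = sym (hop-high-q₂ o o′)
  reach-hop-unique (at-hub o _) (at-hub o′ _) = hop-hub o o′
  reach-hop-unique (at-arm-by-spoke o _) (at-arm-by-spoke o′ _) = hop-armBySpoke o o′
  reach-hop-unique (at-arm-by-spoke o _) (at-arm-low o′) = hop-armBySpoke-armLow o o′
  reach-hop-unique (at-arm-low o) (at-arm-by-spoke o′ _) = sym (hop-armBySpoke-armLow o′ o)
  reach-hop-unique (at-arm-low o) (at-arm-low o′) = hop-armLow o o′
  reach-hop-unique (at-p₂ o) (at-p₂ o′) = hop-p₂ o o′
  reach-hop-unique (at-mid o) (at-mid o′) = hop-mid o o′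
  reach-hop-unique (at-q₂ o) (at-q₂ o′) = hop-q₂ o o′
  reach-hop-unique (at-p₁ o) (at-p₁ o′) = hop-p₁ o o′
  reach-hop-unique (at-q₁ o) (at-q₁ o′) = hop-q₁ o o′
  reach-hop-unique (at-a o) (at-a o′) = hop-a o o′

  reach-start : ∀ {x z e} → Arc x z e → Reach x z z (label e)
  reach-start spoke⁺          = at-arm-by-spoke saHub ≤-refl
  reach-start spoke⁻          = at-hub hbArm ≤-refl
  reach-start legˡ⁺           = at-leaf lfMid ≤-refl
  reach-start legˡ⁻           = in-high-star hiMidL refl ≤-refl
  reach-start (legʳ⁺ {p = p}) = at-mid (mdArm p)
  reach-start legʳ⁻           = at-arm-low laMid
  reach-start ap₁⁺            = at-p₁ p1A
  reach-start ap₁⁻            = at-a aP1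
  reach-start ap₂⁺            = at-leaf lfP2 ≤-refl
  reach-start ap₂⁻            = in-high-star hiP2A refl ≤-refl
  reach-start p₁u₁⁺           = in-high-star hiP1H refl ≤-refl
  reach-start p₁u₁⁻           = at-leaf lfP1 ≤-refl
  reach-start p₂u₁⁺           = at-hub hbP2 z≤n
  reach-start p₂u₁⁻           = at-p₂ p2Hub
  reach-start aq₁⁺            = at-q₁ q1A
  reach-start aq₁⁻            = at-a aQ1
  reach-start aq₂⁺            = at-leaf lfQ2 ≤-refl
  reach-start aq₂⁻            = in-high-star hiQ2A refl ≤-refl
  reach-start q₁u₂⁺           = in-high-star hiQ1Arm refl ≤-refl
  reach-start q₁u₂⁻           = at-leaf lfQ1 ≤-refl
  reach-start q₂u₂⁺           = at-arm-low laQ2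
  reach-start q₂u₂⁻           = at-q₂ q2Arm

  reach-step : ∀ {x z w w′ ℓ f} → Reach x z w ℓ → Arc w w′ f → ℓ ≤ label f → x ≢ w′ →
               Reach x z w′ (label f)
  reach-step (at-leaf lfP1 top≤) ap₁⁻ ≤1 _ = ⊥-elim (top≰1 (≤-trans top≤ ≤1))
  reach-step (at-leaf lfP1 _) p₁u₁⁺ _ x≢ = ⊥-elim (x≢ refl)
  reach-step (at-leaf lfMid _) legˡ⁻ _ x≢ = ⊥-elim (x≢ refl)
  reach-step (at-leaf lfMid top≤) legʳ⁻ ≤1 _ = ⊥-elim (top≰1 (≤-trans top≤ ≤1))
  reach-step (at-leaf lfQ1 top≤) aq₁⁻ ≤1 _ = ⊥-elim (top≰1 (≤-trans top≤ ≤1))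
  reach-step (at-leaf lfQ1 _) q₁u₂⁺ _ x≢ = ⊥-elim (x≢ refl)
  reach-step (at-leaf lfP2 _) ap₂⁻ _ x≢ = ⊥-elim (x≢ refl)
  reach-step (at-leaf lfP2 top≤) p₂u₁⁺ ≤1 _ = ⊥-elim (top≰1 (≤-trans top≤ ≤1))
  reach-step (at-leaf lfQ2 _) aq₂⁻ _ x≢ = ⊥-elim (x≢ refl)
  reach-step (at-leaf lfQ2 top≤) q₂u₂⁺ ≤1 _ = ⊥-elim (top≰1 (≤-trans top≤ ≤1))
  reach-step (in-high-star o star top≤) arc ℓ≤ _ =
    in-high-star o (trans (high-arc-keeps-star arc (≤-trans top≤ ℓ≤)) star) (≤-trans top≤ ℓ≤)
  reach-step (at-hub o t≤) spoke⁺ ℓ≤ x≢ = at-arm-by-spoke (hub⇒armBySpoke o (≤-trans t≤ ℓ≤) x≢) ≤-refl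
  reach-step (at-hub o _) p₁u₁⁻ _ _ = in-high-star (hub⇒high o) refl ≤-refl
  reach-step (at-hub o t≤) p₂u₁⁻ ℓ≤ x≢ = at-p₂ (hub⇒p₂ o (≤-trans t≤ ℓ≤) x≢)
  reach-step (at-arm-by-spoke o _) spoke⁻ _ x≢ with _ , o′ , t≤ ← armBySpoke⇒hub o x≢ = at-hub o′ t≤
  reach-step (at-arm-by-spoke o _) legˡ⁺ _ _ = in-high-star (armBySpoke⇒high o) refl ≤-refl
  reach-step (at-arm-by-spoke _ j≤) (legʳ⁺ {p = i<j}) ≤1 _ =
    ⊥-elim (index≰1 (≤-trans (s≤s z≤n) i<j) (≤-trans j≤ ≤1))
  reach-step (at-arm-by-spoke o _) q₁u₂⁻ _ _ = in-high-star (armBySpoke⇒high o) refl ≤-refl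
  reach-step (at-arm-by-spoke _ j≤) (q₂u₂⁻ {h = h}) ≤1 _ = ⊥-elim (index≰1 h (≤-trans j≤ ≤1))
  reach-step (at-p₂ o) ap₂⁻ _ _ = in-high-star (p₂⇒high o) refl ≤-refl
  reach-step (at-p₂ o) p₂u₁⁺ _ x≢ with _ , o′ , t≤ ← p₂⇒hub o x≢ = at-hub o′ t≤
  reach-step (at-mid o) legˡ⁻ _ x≢ = in-high-star (mid⇒high o x≢) refl ≤-refl
  reach-step (at-mid o) legʳ⁻ _ x≢ = at-arm-low (mid⇒armLow o x≢)
  reach-step (at-arm-low o) spoke⁻ _ _ with _ , o′ , t≤ ← armLow⇒hub o = at-hub o′ t≤
  reach-step (at-arm-low o) legˡ⁺ _ _ = in-high-star (armLow⇒high o) refl ≤-refl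
  reach-step (at-arm-low o) legʳ⁺ _ x≢ = at-mid (armLow⇒mid o x≢)
  reach-step (at-arm-low o) q₁u₂⁻ _ _ = in-high-star (armLow⇒high o) refl ≤-refl
  reach-step (at-arm-low o) q₂u₂⁻ _ x≢ = at-q₂ (armLow⇒q₂ o x≢)
  reach-step (at-q₂ o) aq₂⁻ _ _ = in-high-star (q₂⇒high o) refl ≤-refl
  reach-step (at-q₂ o) q₂u₂⁺ _ x≢ = at-arm-low (q₂⇒armLow o x≢)
  reach-step (at-p₁ o) ap₁⁻ _ x≢ = at-a (p₁⇒a o x≢)
  reach-step (at-p₁ o) p₁u₁⁺ _ _ = in-high-star (p₁⇒high o) refl ≤-refl
  reach-step (at-q₁ o) aq₁⁻ _ x≢ = at-a (q₁⇒a o x≢)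
  reach-step (at-q₁ o) q₁u₂⁺ _ _ = in-high-star (q₁⇒high o) refl ≤-refl
  reach-step (at-a o) ap₁⁺ _ x≢ = at-p₁ (a⇒p₁ o x≢)
  reach-step (at-a o) ap₂⁺ _ _ = in-high-star (a⇒high o) refl ≤-refl
  reach-step (at-a o) aq₁⁺ _ x≢ = at-q₁ (a⇒q₁ o x≢)
  reach-step (at-a o) aq₂⁺ _ _ = in-high-star (a⇒high o) refl ≤-refl

  label-invariant : FirstHopInvariant label
  label-invariant = record
    { Reach            = Reach
    ; reach-start      = λ j → reach-start (arc {top} j)
    ; reach-step       = λ r j → reach-step r (arc {top} j)
    ; reach-hop-unique = reach-hop-unique
    }

  label-good : Good F label
  label-good = good-from-invariant (forcedGadget-noParallelEdges top) label-invariant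

mainTheorem14 : (c : ℕ) → (h : 3 ≤ c) →
    Σ (Labeling (ForcedGadget c)) (λ lab →
        ValuesIn1to (ForcedGadget c) c lab × Good (ForcedGadget c) lab)
    × ((lab : Labeling (ForcedGadget c)) →
         ValuesIn1to (ForcedGadget c) c lab → Good (ForcedGadget c) lab →
         (lab (bone c h) ≡ 1) ⊎ (lab (bone c h) ≡ c))
mainTheorem14 (suc (suc (suc k))) (s≤s (s≤s (s≤s _))) =
  (label , label-range , label-good) , bone-label-extreme k
  where open Canonical (suc k)
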